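{- Let $t$ be a term, $k\in\mathbb{N}$, and $\vec{x}=(x_1,\dots,x_k)$ a list of pairwise distinct variables with $\mathrm{fv}(t)\subseteq\{x_1,\dots,x_k\}$. (1) If $t\in\Lambda_a$, then for every positive type $Q$ there exist positive types $P_1,\dots,P_k$ and a derivation with conclusion $x_1\colon P_1,\dots,x_k\colon P_k\vdash t\colon Q$. (2) If $t\in\Lambda_n$, then there exist positive types $Q,P_1,\dots,P_k$ and a derivation with conclusion $x_1\colon P_1,\dots,x_k\colon P_k\vdash t\colon Q$. (3) If $t$ is $\bar{\mathsf{sh}}$-normal, then $[\![t]\!]_{\vec{x}}\neq\emptyset$.
   Context: Terms: $t ::= x \mid \lambda x.t \mid tu$ up to $\alpha$-conversion; values $v ::= x\mid\lambda x.t$. The sets $\Lambda_a$, $\Lambda_n$ are defined by mutual induction: $a ::= xv \mid xa \mid an$, $n ::= v \mid a \mid (\lambda x.n)a$. Balanced contexts: $B ::= [\cdot] \mid (\lambda x.B)t \mid Bt \mid tB$. Root rules: $(\lambda x.t)v \mapsto_{\beta_v} t\{v/x\}$ ($v$ value); $(\lambda x.t)us \mapsto_{\sigma_1} (\lambda x.ts)u$ if $x\notin\mathrm{fv}(s)$; $v((\lambda x.s)u) \mapsto_{\sigma_3} (\lambda x.vs)u$ if $v$ value and $x\notin\mathrm{fv}(v)$. $\to_{\bar{\mathsf{sh}}}$ is the closure of their union under balanced contexts; $\bar{\mathsf{sh}}$-normal means no such step applies. Types: negative $N ::= P\multimap Q$; positive $P,Q ::= [N_1,\dots,N_n]$ finite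 multisets ($n\ge0$), $\mathbf{0}$ the empty multiset. Environments: maps from variables to positive types, $\mathbf{0}$ almost everywhere; $\uplus$ pointwise multiset sum. Rules: (ax) $x\colon P\vdash x\colon P$; (@) from $\Gamma\vdash t\colon[P\multimap Q]$ and $\Gamma'\vdash u\colon P$ infer $\Gamma\uplus\Gamma'\vdash tu\colon Q$; ($\lambda$) for $n\ge0$, from $\Gamma_i,x\colon P_i\vdash t\colon Q_i$ ($1\le i\le n$) infer $\biguplus_i\Gamma_i\vdash\lambda x.t\colon[P_1\multimap Q_1,\dots,P_n\multimap Q_n]$. Semantics: $[\![t]\!]_{\vec{x}} = \{((P_1,\dots,P_k),Q) \mid \text{there is a derivation of } x_1\colon P_1,\dots,x_k\colon P_k \vdash t \colon Q\}$. -}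

module Defs where

open import Data.Nat using (ℕ; zero; suc)
open import Data.Fin using (Fin; zero; suc)
open import Data.List using (List; []; _∷_; _++_)
open import Data.Vec using (Vec; []; _∷_; replicate; zipWith; _[_]≔_)
open import Data.Product using (Σ; ∃; _×_; _,_)
open import Relation.Nullary using (¬_)

-- Terms, well-scoped de Bruijn (α-conversion is built in).
-- Term k = terms whose free variables are among x₁ … x_k (pairwise
-- distinct), variable i : Fin k standing for x_{i+1}.

infixl 7 _·_
data Term (k : ℕ) : Set where
  var : Fin k → Term k
  lam : Term (suc k) → Term k
  _·_ : Term k → Term k → Term k

Ren : ℕ → ℕ → Set
Ren k l = Fin k → Fin l

ext : ∀ {k l} → Ren k l → Ren (suc k) (suc l)
ext ρ zero    = zero
ext ρ (suc i) = suc (ρ i)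

rename : ∀ {k l} → Ren k l → Term k → Term l
rename ρ (var i) = var (ρ i)
rename ρ (lam t) = lam (rename (ext ρ) t)
rename ρ (t · u) = rename ρ t · rename ρ u

weaken : ∀ {k} → Term k → Term (suc k)
weaken = rename suc

Sub : ℕ → ℕ → Set
Sub k l = Fin k → Term l

exts : ∀ {k l} → Sub k l → Sub (suc k) (suc l)
exts σ zero    = var zero
exts σ (suc i) = weaken (σ i)

subst : ∀ {k l} → Sub k l → Term k → Term l
subst σ (var i) = σ i
subst σ (lam t) = lam (subst (exts σ) t)
subst σ (t · u) = subst σ t · subst σ u

single : ∀ {k} → Term k → Sub (suc k) k
single v zero    = v
single v (suc i) = var i

_[_/0] : ∀ {k} → Term (suc k) → Term k → Term k
t [ v /0] = subst (single v) t

data IsValue {k} : Term k → Set where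
  v-var : ∀ i → IsValue (var i)
  v-lam : ∀ t → IsValue (lam t)

data IsA {k} : Term k → Set
data IsN {k} : Term k → Set

data IsA {k} where
  a-xv : ∀ {i v} → IsValue v → IsA (var i · v)
  a-xa : ∀ {i a} → IsA a → IsA (var i · a)
  a-an : ∀ {a n} → IsA a → IsN n → IsA (a · n)

data IsN {k} where
  n-v   : ∀ {v} → IsValue v → IsN v
  n-a   : ∀ {a} → IsA a → IsN a
  n-red : ∀ {n : Term (suc k)} {a} → IsN n → IsA a → IsN (lam n · a)

-- Root rules and their closure under balanced contexts
--   B ::= [·] | (λx.B)t | Bt | tB

data _↦_ {k} : Term k → Term k → Set where
  βv : ∀ {t v} → IsValue v → (lam t · v) ↦ (t [ v /0])
  -- (λx.t)u s ↦ (λx.ts)u, x ∉ fv(s) (s lives outside the binder)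
  σ₁ : ∀ {t u s} → (lam t · u · s) ↦ (lam (t · weaken s) · u)
  -- v((λx.s)u) ↦ (λx.vs)u, v value, x ∉ fv(v)
  σ₃ : ∀ {v s u} → IsValue v → (v · (lam s · u)) ↦ (lam (weaken v · s) · u)

data _⟶_ {k} : Term k → Term k → Set where
  root : ∀ {t t'} → t ↦ t' → t ⟶ t'
  ctx-lam : ∀ {t t' : Term (suc k)} {u} → t ⟶ t' → (lam t · u) ⟶ (lam t' · u)
  ctx-fun : ∀ {t t' u} → t ⟶ t' → (t · u) ⟶ (t' · u)
  ctx-arg : ∀ {t u u'} → u ⟶ u' → (t · u) ⟶ (t · u')

ShNormal : ∀ {k} → Term k → Set
ShNormal t = ¬ (∃ λ t' → t ⟶ t')

-- Types. Positive types are finite multisets of negative types,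
-- represented by lists and compared up to multiset equality _≈P_.

data Neg : Set where
  _⊸_ : List Neg → List Neg → Neg

Pos : Set
Pos = List Neg

𝟎 : Pos
𝟎 = []

data _≈N_ : Neg → Neg → Set
data _≈P_ : Pos → Pos → Set

data _≈N_ where
  ⊸-cong : ∀ {P P' Q Q'} → P ≈P P' → Q ≈P Q' → (P ⊸ Q) ≈N (P' ⊸ Q')

data _≈P_ where
  []    : [] ≈P []
  _∷_   : ∀ {N N' P P'} → N ≈N N' → P ≈P P' → (N ∷ P) ≈P (N' ∷ P')
  swap  : ∀ {N M P} → (N ∷ M ∷ P) ≈P (M ∷ N ∷ P)
  trans : ∀ {P P' P''} → P ≈P P' → P' ≈P P'' → P ≈P P''

-- Environments on x₁ … x_k (𝟎 on every other variable)
Env : ℕ → Set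
Env k = Vec Pos k

_⊎E_ : ∀ {k} → Env k → Env k → Env k
_⊎E_ = zipWith _++_

𝟎E : ∀ {k} → Env k
𝟎E = replicate _ 𝟎

single-env : ∀ {k} → Fin k → Pos → Env k
single-env i P = 𝟎E [ i ]≔ P

data _⊢_∶_ {k} : Env k → Term k → Pos → Set
-- the family of n ≥ 0 premises of rule (λ)
data Lams {k} (t : Term (suc k)) : Env k → Pos → Set

data _⊢_∶_ {k} where
  ax  : ∀ i P → single-env i P ⊢ var i ∶ P
  app : ∀ {Γ Γ' t u P P' Q} →
        Γ ⊢ t ∶ (P ⊸ Q ∷ []) → Γ' ⊢ u ∶ P' → P ≈P P' →
        (Γ ⊎E Γ') ⊢ t · u ∶ Q
  abs : ∀ {Γ t R} → Lams t Γ R → Γ ⊢ lam t ∶ R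

data Lams {k} t where
  none : Lams t 𝟎E []
  more : ∀ {Γ Γ' P Q R} → (P ∷ Γ) ⊢ t ∶ Q → Lams t Γ' R →
         Lams t (Γ ⊎E Γ') ((P ⊸ Q) ∷ R)

⟦_⟧ : ∀ {k} → Term k → Env k × Pos → Set
⟦ t ⟧ (Γ , Q) = Γ ⊢ t ∶ Q

NonEmpty : ∀ {k} → (Env k × Pos → Set) → Set
NonEmpty {k} S = Σ (Env k × Pos) S

-- A term of Λ_a is headed by a variable, whose type in the axiom can be
-- chosen freely, so it accepts any target type Q. Values get the empty
-- multiset 𝟎 by the (λ) rule with no premises; the redex (λx.n)a is typed by
-- first typing n, reading off the type P it assigns to x, and then asking a
-- for type P. Finally every s̄h-normal term lies in Λ_n, since every other
-- shape of an application exposes a βv, σ₁ or σ₃ redex.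
module Submission where

open import Defs
open import Data.Nat using (ℕ; suc)
open import Data.Product using (Σ; _×_; _,_)
open import Data.List using ([]; _∷_)
open import Data.Vec using (_∷_)
open import Relation.Nullary using (contradiction)

≈P-refl : ∀ P → P ≈P P
≈N-refl : ∀ N → N ≈N N
≈P-refl []      = []
≈P-refl (N ∷ P) = ≈N-refl N ∷ ≈P-refl P
≈N-refl (P ⊸ Q) = ⊸-cong (≈P-refl P) (≈P-refl Q)

value⊢𝟎 : ∀ {k} {v : Term k} → IsValue v → Σ (Env k) (λ Γ → Γ ⊢ v ∶ 𝟎)
value⊢𝟎 (v-var i) = _ , ax i 𝟎
value⊢𝟎 (v-lam t) = _ , abs none

var·⊢ : ∀ {k} i {u : Term k} {Γ} → Γ ⊢ u ∶ 𝟎 → ∀ Q →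
        Σ (Env k) (λ Δ → Δ ⊢ var i · u ∶ Q)
var·⊢ i d Q = _ , app (ax i ((𝟎 ⊸ Q) ∷ [])) d []

IsA⇒typable : ∀ {k} {t : Term k} → IsA t → ∀ Q → Σ (Env k) (λ Γ → Γ ⊢ t ∶ Q)
IsN⇒typable : ∀ {k} {t : Term k} → IsN t → Σ Pos (λ Q → Σ (Env k) (λ Γ → Γ ⊢ t ∶ Q))

IsA⇒typable (a-xv {i} v) Q = let _ , d = value⊢𝟎 v in var·⊢ i d Q
IsA⇒typable (a-xa {i} a) Q = let _ , d = IsA⇒typable a 𝟎 in var·⊢ i d Q
IsA⇒typable (a-an a n)   Q =
  let P , _ , dn = IsN⇒typable n
      _ , da     = IsA⇒typable a ((P ⊸ Q) ∷ [])
  in  _ , app da dn (≈P-refl P)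

IsN⇒typable (n-v v) = 𝟎 , value⊢𝟎 v
IsN⇒typable (n-a a) = 𝟎 , IsA⇒typable a 𝟎
IsN⇒typable (n-red n a) with IsN⇒typable n
... | Q , P ∷ Γ , dn =
  let _ , da = IsA⇒typable a P
  in  Q , _ , app (abs (more dn none)) da (≈P-refl P)

shNormal-fun : ∀ {k} {t u : Term k} → ShNormal (t · u) → ShNormal t
shNormal-fun h (_ , r) = h (_ , ctx-fun r)

shNormal-arg : ∀ {k} {t u : Term k} → ShNormal (t · u) → ShNormal u
shNormal-arg h (_ , r) = h (_ , ctx-arg r)

shNormal-body : ∀ {k} {s : Term (suc k)} {u} → ShNormal (lam s · u) → ShNormal s
shNormal-body h (_ , r) = h (_ , ctx-lam r)

shNormal⇒IsN : ∀ {k} (t : Term k) → ShNormal t → IsN t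
shNormal-app⇒IsN : ∀ {k} (t u : Term k) → IsN t → IsN u → ShNormal (t · u) → IsN (t · u)

shNormal⇒IsN (var i) _ = n-v (v-var i)
shNormal⇒IsN (lam t) _ = n-v (v-lam t)
shNormal⇒IsN (t · u) h =
  shNormal-app⇒IsN t u (shNormal⇒IsN t (shNormal-fun h))
                       (shNormal⇒IsN u (shNormal-arg h)) h

shNormal-app⇒IsN _ _ (n-v (v-var i)) (n-v v)     _ = n-a (a-xv v)
shNormal-app⇒IsN _ _ (n-v (v-var i)) (n-a a)     _ = n-a (a-xa a)
shNormal-app⇒IsN _ _ (n-v (v-lam s)) (n-a a)     h = n-red (shNormal⇒IsN s (shNormal-body h)) a
shNormal-app⇒IsN _ _ (n-v (v-lam s)) (n-v v)     h = contradiction (_ , root (βv v)) h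
shNormal-app⇒IsN _ _ (n-v v)         (n-red _ _) h = contradiction (_ , root (σ₃ v)) h
shNormal-app⇒IsN _ _ (n-a a)         n           _ = n-a (a-an a n)
shNormal-app⇒IsN _ _ (n-red _ _)     _           h = contradiction (_ , root σ₁) h

lemma4p3 : ∀ {k : ℕ} (t : Term k) →
    (IsA t → ∀ (Q : Pos) → Σ (Env k) (λ Γ → Γ ⊢ t ∶ Q))
    × (IsN t → Σ Pos (λ Q → Σ (Env k) (λ Γ → Γ ⊢ t ∶ Q)))
    × (ShNormal t → NonEmpty ⟦ t ⟧)
lemma4p3 t = IsA⇒typable , IsN⇒typable , semantics-nonempty
  where
  semantics-nonempty : ShNormal t → NonEmpty ⟦ t ⟧
  semantics-nonempty h with IsN⇒typable (shNormal⇒IsN t h)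
  ... | Q , Γ , d = (Γ , Q) , d
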